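{- Let $S\subseteq\Sigma^*$ be a poset-diary. Then all words in $\overline S$ are mutually compatible. Moreover, for each $\ell<\sup_{w\in S}|w|$, writing $\mathbf S_\ell$ for the level structure of $\overline S_\ell$ and $\mathbf S_{\ell+1}$ for the level structure of $\overline S_{\ell+1}$, and letting $\rho:\overline S_{\ell+1}\to\overline S_\ell$, $\rho(z)=z|_\ell$: (1) if level $\ell$ is a Leaf level with leaf word $w$, then $\rho$ is an isomorphism from $\mathbf S_{\ell+1}$ onto the substructure of $\mathbf S_\ell$ on $\overline S_\ell\setminus\{w\}$ (i.e. $\mathbf S_{\ell+1}$ is $\mathbf S_\ell$ with one vertex removed); (2) if level $\ell$ is a Splitting level at $w$, then $\mathbf S_{\ell+1}$ is isomorphic to $\mathbf S_\ell$ with the vertex $w$ duplicated into two vertices $w'=w^\frown\mathrm X$, $w''=w^\frown\mathrm R$ (each of them relating to all other vertices as $w$ does, via $\rho$), where $w'<_{\mathrm{lex}}w''$, $w'\not\preceq w''$, $w''\not\preceq w'$ and $w'\trianglelefteq w''$; (3) if level $\ell$ is a New $\perp$ level, then $\rho$ is a bijection preserving $\leq_{\mathrm{lex}}$ and $\preceq$ in both directions, and $\mathbf S_{\ell+1}$ is $\mathbf S_\ell$ with exactly one pair removed from the relation $\vartriangleleft$ (and thus exactly one pair added to $\perp$); (4) if level $\ell$ is a New $\prec$ level, then $\rho$ is a bijection preserving $\leq_{\mathrm{lex}}$ and $\trianglelefteq$ in both directions, and $\mathbf S_{\ell+1}$ is $\mathbf S_\ell$ extended by exactly one pair in the relation 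$\prec$.
   Context: Let $\Sigma=\{\mathrm L,\mathrm X,\mathrm R\}$ with $\mathrm L<_{\mathrm{lex}}\mathrm X<_{\mathrm{lex}}\mathrm R$; $\Sigma^*$ is the set of finite words with lexicographic order $\leq_{\mathrm{lex}}$; $|w|$ is the length, $w|_i$ the initial segment of length $i$, $w^\frown c$ the word $w$ followed by letter $c$, $A^\frown c=\{w^\frown c:w\in A\}$; $\Sigma^*_\ell$ is the set of words of length $\ell$. For $S\subseteq\Sigma^*$: $\overline S=\{w|_i:w\in S,0\leq i\leq|w|\}$ and $\overline S_\ell$ is the set of words of length $\ell$ in $\overline S$. Relations: $w\prec w'$ iff there is $i<\min(|w|,|w'|)$ with $(w_i,w'_i)=(\mathrm L,\mathrm R)$ and $w_j\leq_{\mathrm{lex}}w'_j$ for all $j<i$; $w\preceq w'$ iff $w\prec w'$ or $w=w'$. For $w,w'$ of the same length $\ell$: $w\trianglelefteq w'$ iff $w_i\leq_{\mathrm{lex}}w'_i$ for all $i<\ell$; $w\vartriangleleft w'$ iff $w\trianglelefteq w'$ and $w\neq w'$; $w\perp w'$ iff they are $\trianglelefteq$-incomparable; $w,w'$ are related if $w\preceq w'$, $w'\preceq w$ or $w\perp w'$, and unrelated otherwise. Words $u\leq_{\mathrm{lex}}v$ are compatible if (1) no $\ell<\min(|u|,|v|)$ has $(u_\ell,v_\ell)=(\mathrm R,\mathrm L)$, and (2) if some $\ell'<\min(|u|,|v|)$ has $(u_{\ell'},v_{\ell'})=(\mathrm L,\mathrm R)$ then $u_{\ell''}\leq_{\mathrm{lex}}v_{\ell''}$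 for all $\ell''<\min(|u|,|v|)$. For $A\subseteq\Sigma^*_\ell$, its level structure is $(A,\leq_{\mathrm{lex}},\preceq,\trianglelefteq)$. Poset-diary: $S\subseteq\Sigma^*$ is a poset-diary if no member of $S$ is a proper initial segment of another and, for every $\ell$ with $0\leq\ell<\sup_{w\in S}|w|$, precisely one of the following holds: (Leaf) there is $w\in\overline S_\ell$ related to every $u\in\overline S_\ell\setminus\{w\}$ and $\overline S_{\ell+1}=(\overline S_\ell\setminus\{w\})^\frown\mathrm X$. (Splitting) there is $w\in\overline S_\ell$ with $\overline S_{\ell+1}=\{z\in\overline S_\ell:z<_{\mathrm{lex}}w\}^\frown\mathrm X\cup\{w^\frown\mathrm X,w^\frown\mathrm R\}\cup\{z\in\overline S_\ell:w<_{\mathrm{lex}}z\}^\frown\mathrm R$. (New $\perp$) there are unrelated $v<_{\mathrm{lex}}w$ in $\overline S_\ell$ such that every $u\in\overline S_\ell$ with $v<_{\mathrm{lex}}u<_{\mathrm{lex}}w$ satisfies $u\perp v$ or $u\perp w$, and $\overline S_{\ell+1}=\{z:z<_{\mathrm{lex}}v\}^\frown\mathrm X\cup\{v^\frown\mathrm R\}\cup\{z:v<_{\mathrm{lex}}z<_{\mathrm{lex}}w,\ z\perp v\}^\frown\mathrm X\cup\{z:v<_{\mathrm{lex}}z<_{\mathrm{lex}}w,\ z\not\perp v\}^\frown\mathrm R\cup\{w^\frown\mathrm X\}\cup\{z:w<_{\mathrm{lex}}z\}^\frown\mathrm R$ (all $z$ ranging over $\overline S_\ell$). (New $\prec$) there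 are unrelated $v<_{\mathrm{lex}}w$ in $\overline S_\ell$ such that (B1) every $u\in\overline S_\ell$ with $u<_{\mathrm{lex}}v$ satisfies $u\preceq w$ or $u\perp v$, (B2) every $u\in\overline S_\ell$ with $w<_{\mathrm{lex}}u$ satisfies $v\preceq u$ or $w\perp u$, and $\overline S_{\ell+1}=\{z:z<_{\mathrm{lex}}v,\ z\perp v\}^\frown\mathrm X\cup\{z:z<_{\mathrm{lex}}v,\ z\not\perp v\}^\frown\mathrm L\cup\{v^\frown\mathrm L\}\cup\{z:v<_{\mathrm{lex}}z<_{\mathrm{lex}}w\}^\frown\mathrm X\cup\{w^\frown\mathrm R\}\cup\{z:w<_{\mathrm{lex}}z,\ w\perp z\}^\frown\mathrm X\cup\{z:w<_{\mathrm{lex}}z,\ w\not\perp z\}^\frown\mathrm R$ (all $z$ ranging over $\overline S_\ell$). The level $\ell$ is called a Leaf / Splitting / New $\perp$ / New $\prec$ level accordingly. -}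

module Defs where

open import Data.Nat using (ℕ; suc; _<_; _≤_)
open import Data.List using (List; []; _∷_; take; length; zip; _∷ʳ_)
open import Data.List.Membership.Propositional using (_∈_)
open import Data.List.Relation.Unary.All using (All)
open import Data.List.Relation.Binary.Pointwise using (Pointwise)
open import Data.Product using (Σ; ∃; _×_; _,_; proj₁; proj₂)
open import Data.Sum using (_⊎_)
open import Data.Empty using (⊥)
open import Relation.Nullary using (¬_)
open import Relation.Binary.PropositionalEquality using (_≡_; _≢_)
open import Function.Bundles using (_⇔_)

data Letter : Set where
  L X R : Letter

data _<L_ : Letter → Letter → Set where
  L<X : L <L X
  L<R : L <L R
  X<R : X <L R

_≤L_ : Letter → Letter → Set
a ≤L b = a <L b ⊎ a ≡ b

Word : Set
Word = List Letter

-- w ⌢ c  is  w ∷ʳ c ;  w|_i  is  take i w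

data _<lex_ : Word → Word → Set where
  halt : ∀ {c w} → [] <lex (c ∷ w)
  this : ∀ {c c' w w'} → c <L c' → (c ∷ w) <lex (c' ∷ w')
  next : ∀ {c w w'} → w <lex w' → (c ∷ w) <lex (c ∷ w')

_≤lex_ : Word → Word → Set
u ≤lex v = u <lex v ⊎ u ≡ v

-- w ≺ w' : some i < min(|w|,|w'|) with (w_i,w'_i) = (L,R) and
-- w_j ≤lex w'_j for all j < i.

data _≺_ : Word → Word → Set where
  here  : ∀ {w w'} → (L ∷ w) ≺ (R ∷ w')
  there : ∀ {c c' w w'} → c ≤L c' → w ≺ w' → (c ∷ w) ≺ (c' ∷ w')

_⪯_ : Word → Word → Set
w ⪯ w' = w ≺ w' ⊎ w ≡ w'

_⊴_ : Word → Word → Set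
w ⊴ w' = Pointwise _≤L_ w w'

_◁_ : Word → Word → Set
w ◁ w' = w ⊴ w' × w ≢ w'

_⊥w_ : Word → Word → Set
w ⊥w w' = ¬ (w ⊴ w') × ¬ (w' ⊴ w)

Related : Word → Word → Set
Related w w' = w ⪯ w' ⊎ w' ⪯ w ⊎ w ⊥w w'

Unrelated : Word → Word → Set
Unrelated w w' = ¬ Related w w'

-- Compatibility of u ≤lex v (the pairs (u_ℓ, v_ℓ) for ℓ < min(|u|,|v|)
-- are exactly the entries of zip u v).
Compatible : Word → Word → Set
Compatible u v =
  ¬ ((R , L) ∈ zip u v)
  × ((L , R) ∈ zip u v → All (λ p → proj₁ p ≤L proj₂ p) (zip u v))

Sbar : (Word → Set) → Word → Set
Sbar S u = Σ Word λ w → S w × Σ ℕ λ i → i ≤ length w × take i w ≡ u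

SbarAt : (Word → Set) → ℕ → Word → Set
SbarAt S ℓ u = Sbar S u × length u ≡ ℓ

BelowSup : (Word → Set) → ℕ → Set
BelowSup S ℓ = Σ Word λ w → S w × ℓ < length w

PrefixFree : (Word → Set) → Set
PrefixFree S = ∀ w w' → S w → S w' → ∀ i → i < length w' → take i w' ≢ w

LeafAt : (Word → Set) → ℕ → Word → Set
LeafAt S ℓ w =
  SbarAt S ℓ w
  × (∀ u → SbarAt S ℓ u → u ≢ w → Related w u)
  × (∀ z → SbarAt S (suc ℓ) z ⇔
           (Σ Word λ u → SbarAt S ℓ u × u ≢ w × z ≡ u ∷ʳ X))

SplitAt : (Word → Set) → ℕ → Word → Set
SplitAt S ℓ w =
  SbarAt S ℓ w
  × (∀ z → SbarAt S (suc ℓ) z ⇔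
       (Σ Word λ u → SbarAt S ℓ u ×
          ((u <lex w × z ≡ u ∷ʳ X)
           ⊎ (u ≡ w × (z ≡ w ∷ʳ X ⊎ z ≡ w ∷ʳ R))
           ⊎ (w <lex u × z ≡ u ∷ʳ R))))

NewPerpAt : (Word → Set) → ℕ → Word → Word → Set
NewPerpAt S ℓ v w =
  SbarAt S ℓ v × SbarAt S ℓ w × v <lex w × Unrelated v w
  × (∀ u → SbarAt S ℓ u → v <lex u → u <lex w → u ⊥w v ⊎ u ⊥w w)
  × (∀ z → SbarAt S (suc ℓ) z ⇔
       (Σ Word λ u → SbarAt S ℓ u ×
          ((u <lex v × z ≡ u ∷ʳ X)
           ⊎ (u ≡ v × z ≡ v ∷ʳ R)
           ⊎ (v <lex u × u <lex w × u ⊥w v × z ≡ u ∷ʳ X)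
           ⊎ (v <lex u × u <lex w × ¬ (u ⊥w v) × z ≡ u ∷ʳ R)
           ⊎ (u ≡ w × z ≡ w ∷ʳ X)
           ⊎ (w <lex u × z ≡ u ∷ʳ R))))

NewPrecAt : (Word → Set) → ℕ → Word → Word → Set
NewPrecAt S ℓ v w =
  SbarAt S ℓ v × SbarAt S ℓ w × v <lex w × Unrelated v w
  × (∀ u → SbarAt S ℓ u → u <lex v → u ⪯ w ⊎ u ⊥w v)
  × (∀ u → SbarAt S ℓ u → w <lex u → v ⪯ u ⊎ w ⊥w u)
  × (∀ z → SbarAt S (suc ℓ) z ⇔
       (Σ Word λ u → SbarAt S ℓ u ×
          ((u <lex v × u ⊥w v × z ≡ u ∷ʳ X)
           ⊎ (u <lex v × ¬ (u ⊥w v) × z ≡ u ∷ʳ L)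
           ⊎ (u ≡ v × z ≡ v ∷ʳ L)
           ⊎ (v <lex u × u <lex w × z ≡ u ∷ʳ X)
           ⊎ (u ≡ w × z ≡ w ∷ʳ R)
           ⊎ (w <lex u × w ⊥w u × z ≡ u ∷ʳ X)
           ⊎ (w <lex u × ¬ (w ⊥w u) × z ≡ u ∷ʳ R))))

LeafLevel SplittingLevel NewPerpLevel NewPrecLevel : (Word → Set) → ℕ → Set
LeafLevel S ℓ = Σ Word λ w → LeafAt S ℓ w
SplittingLevel S ℓ = Σ Word λ w → SplitAt S ℓ w
NewPerpLevel S ℓ = Σ Word λ v → Σ Word λ w → NewPerpAt S ℓ v w
NewPrecLevel S ℓ = Σ Word λ v → Σ Word λ w → NewPrecAt S ℓ v w

ExactlyOne4 : Set → Set → Set → Set → Set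
ExactlyOne4 A B C D =
  (A ⊎ B ⊎ C ⊎ D)
  × ¬ (A × B) × ¬ (A × C) × ¬ (A × D)
  × ¬ (B × C) × ¬ (B × D) × ¬ (C × D)

PosetDiary : (Word → Set) → Set
PosetDiary S =
  PrefixFree S
  × (∀ ℓ → BelowSup S ℓ →
       ExactlyOne4 (LeafLevel S ℓ) (SplittingLevel S ℓ)
                   (NewPerpLevel S ℓ) (NewPrecLevel S ℓ))

ρ : ℕ → Word → Word
ρ ℓ z = take ℓ z

BijOnto : (Word → Set) → ℕ → (Word → Set) → Set
BijOnto S ℓ T =
  (∀ z → SbarAt S (suc ℓ) z → T (ρ ℓ z))
  × (∀ z z' → SbarAt S (suc ℓ) z → SbarAt S (suc ℓ) z' → ρ ℓ z ≡ ρ ℓ z' → z ≡ z')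
  × (∀ u → T u → Σ Word λ z → SbarAt S (suc ℓ) z × ρ ℓ z ≡ u)

Preserves : (Word → Set) → ℕ → (Word → Word → Set) → Set
Preserves S ℓ Rel =
  ∀ z z' → SbarAt S (suc ℓ) z → SbarAt S (suc ℓ) z' → Rel z z' ⇔ Rel (ρ ℓ z) (ρ ℓ z')

LeafConcl : (Word → Set) → ℕ → Word → Set
LeafConcl S ℓ w =
  BijOnto S ℓ (λ u → SbarAt S ℓ u × u ≢ w)
  × Preserves S ℓ _≤lex_ × Preserves S ℓ _⪯_ × Preserves S ℓ _⊴_

SplitConcl : (Word → Set) → ℕ → Word → Set
SplitConcl S ℓ w =
  (∀ z → SbarAt S (suc ℓ) z → SbarAt S ℓ (ρ ℓ z))
  × (∀ u → SbarAt S ℓ u → Σ Word λ z → SbarAt S (suc ℓ) z × ρ ℓ z ≡ u)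
  × SbarAt S (suc ℓ) (w ∷ʳ X) × SbarAt S (suc ℓ) (w ∷ʳ R)
  × ρ ℓ (w ∷ʳ X) ≡ w × ρ ℓ (w ∷ʳ R) ≡ w
  × (∀ z → SbarAt S (suc ℓ) z → ρ ℓ z ≡ w → z ≡ w ∷ʳ X ⊎ z ≡ w ∷ʳ R)
  × (∀ z z' → SbarAt S (suc ℓ) z → SbarAt S (suc ℓ) z' →
       ρ ℓ z ≡ ρ ℓ z' → ρ ℓ z ≢ w → z ≡ z')
  × (∀ z z' → SbarAt S (suc ℓ) z → SbarAt S (suc ℓ) z' → ρ ℓ z ≢ ρ ℓ z' →
       (z ≤lex z' ⇔ ρ ℓ z ≤lex ρ ℓ z')
       × (z ⪯ z' ⇔ ρ ℓ z ⪯ ρ ℓ z')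
       × (z ⊴ z' ⇔ ρ ℓ z ⊴ ρ ℓ z'))
  × (w ∷ʳ X) <lex (w ∷ʳ R)
  × ¬ ((w ∷ʳ X) ⪯ (w ∷ʳ R))
  × ¬ ((w ∷ʳ R) ⪯ (w ∷ʳ X))
  × (w ∷ʳ X) ⊴ (w ∷ʳ R)

NewPerpConcl : (Word → Set) → ℕ → Set
NewPerpConcl S ℓ =
  BijOnto S ℓ (SbarAt S ℓ)
  × Preserves S ℓ _≤lex_ × Preserves S ℓ _⪯_
  × (Σ Word λ a → Σ Word λ b → SbarAt S ℓ a × SbarAt S ℓ b × a ◁ b ×
       (∀ z z' → SbarAt S (suc ℓ) z → SbarAt S (suc ℓ) z' →
          (z ◁ z' ⇔ (ρ ℓ z ◁ ρ ℓ z' × ¬ (ρ ℓ z ≡ a × ρ ℓ z' ≡ b)))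
          × (z ⊥w z' ⇔ (ρ ℓ z ⊥w ρ ℓ z'
                         ⊎ (ρ ℓ z ≡ a × ρ ℓ z' ≡ b)
                         ⊎ (ρ ℓ z ≡ b × ρ ℓ z' ≡ a)))))

NewPrecConcl : (Word → Set) → ℕ → Set
NewPrecConcl S ℓ =
  BijOnto S ℓ (SbarAt S ℓ)
  × Preserves S ℓ _≤lex_ × Preserves S ℓ _⊴_
  × (Σ Word λ a → Σ Word λ b → SbarAt S ℓ a × SbarAt S ℓ b × ¬ (a ≺ b) ×
       (∀ z z' → SbarAt S (suc ℓ) z → SbarAt S (suc ℓ) z' →
          z ≺ z' ⇔ (ρ ℓ z ≺ ρ ℓ z' ⊎ (ρ ℓ z ≡ a × ρ ℓ z' ≡ b))))

{-# OPTIONS --safe #-}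
-- At level ℓ every word of S̄_{ℓ+1} is a word u of S̄_ℓ followed by one letter a, and the clause
-- defining the level is read as a relation Tail u a.  Comparing u⌢a with u'⌢b reduces to comparing
-- u with u' and a with b, so each part of the theorem becomes a property of Tail on S̄_ℓ: at Leaf,
-- New ⊥ and New ≺ levels it is a function of u; at Leaf, Splitting and New ⊥ levels it never
-- yields L, so ≺ is unchanged; it is monotone for ⊴, except that at a New ⊥ level the pair (v, w)
-- receives (R, X); and at a New ≺ level an L-tail under an R-tail occurs only along ≺ or at (v, w).
-- Compatibility then follows level by level: a new last pair (R, L) never arises, a new last pair
-- (L, R) arises only between ⊴-comparable words, and tails are monotone along ≺ ∩ ⊴.

module Submission where

open import Defs
open import Data.Nat using (ℕ; zero; suc; _≤_; _⊓_)
open import Data.Nat.Properties using (suc-injective; m⊓n≤m; m⊓n≤n; ≤-trans; m≤n⇒m⊓n≡m)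
open import Data.List using (List; []; _∷_; take; length; zip; _∷ʳ_)
open import Data.List.Properties using (∷ʳ-injectiveˡ; ∷ʳ-injectiveʳ; ≡-dec; take-take; length-take)
open import Data.List.Membership.Propositional using (_∈_)
open import Data.List.Membership.Propositional.Properties using (∈-++⁻)
open import Data.List.Relation.Unary.Any using (here; there)
open import Data.List.Relation.Unary.All using (All; []; _∷_)
open import Data.List.Relation.Unary.All.Properties using (∷ʳ⁺)
open import Data.List.Relation.Binary.Pointwise as Pointwise using ([]; _∷_; ++⁺)
open import Data.Product using (Σ; _×_; _,_; proj₁; proj₂; map₂; swap)
open import Data.Sum using (_⊎_; inj₁; inj₂)
open import Data.Empty using (⊥; ⊥-elim)
open import Function using (_∘_)
open import Function.Bundles using (_⇔_; mk⇔; Equivalence)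
open import Relation.Nullary using (¬_; Dec; yes; no; ¬?; _×-dec_)
open import Relation.Binary.PropositionalEquality using (_≡_; _≢_; refl; sym; trans; cong; subst; subst₂)

-- Letters and words

<L-irrefl : ∀ {a} → ¬ (a <L a)
<L-irrefl ()

<L-trans : ∀ {a b c} → a <L b → b <L c → a <L c
<L-trans L<X X<R = L<R

<L-trichotomy : ∀ a b → a <L b ⊎ a ≡ b ⊎ b <L a
<L-trichotomy L L = inj₂ (inj₁ refl)
<L-trichotomy L X = inj₁ L<X
<L-trichotomy L R = inj₁ L<R
<L-trichotomy X L = inj₂ (inj₂ L<X)
<L-trichotomy X X = inj₂ (inj₁ refl)
<L-trichotomy X R = inj₁ X<R
<L-trichotomy R L = inj₂ (inj₂ L<R)
<L-trichotomy R X = inj₂ (inj₂ X<R)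
<L-trichotomy R R = inj₂ (inj₁ refl)

≤L-refl : ∀ {a} → a ≤L a
≤L-refl = inj₂ refl

≤L-trans : ∀ {a b c} → a ≤L b → b ≤L c → a ≤L c
≤L-trans (inj₁ a<b) (inj₁ b<c) = inj₁ (<L-trans a<b b<c)
≤L-trans (inj₁ a<b) (inj₂ refl) = inj₁ a<b
≤L-trans (inj₂ refl) b≤c = b≤c

<L⇒≱L : ∀ {a b} → a <L b → ¬ (b ≤L a)
<L⇒≱L a<b (inj₁ b<a) = <L-irrefl (<L-trans a<b b<a)
<L⇒≱L a<b (inj₂ refl) = <L-irrefl a<b

≤L-antisym : ∀ {a b} → a ≤L b → b ≤L a → a ≡ b
≤L-antisym (inj₁ a<b) b≤a = ⊥-elim (<L⇒≱L a<b b≤a)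
≤L-antisym (inj₂ a≡b) _ = a≡b

_≤L?_ : ∀ a b → Dec (a ≤L b)
a ≤L? b with <L-trichotomy a b
... | inj₁ a<b = yes (inj₁ a<b)
... | inj₂ (inj₁ a≡b) = yes (inj₂ a≡b)
... | inj₂ (inj₂ b<a) = no (<L⇒≱L b<a)

_≟L_ : ∀ (a b : Letter) → Dec (a ≡ b)
a ≟L b with <L-trichotomy a b
... | inj₁ a<b = no λ { refl → <L-irrefl a<b }
... | inj₂ (inj₁ a≡b) = yes a≡b
... | inj₂ (inj₂ b<a) = no λ { refl → <L-irrefl b<a }

_≟W_ : ∀ (u v : Word) → Dec (u ≡ v)
_≟W_ = ≡-dec _≟L_

<lex-irrefl : ∀ {u} → ¬ (u <lex u)
<lex-irrefl (this a<a) = <L-irrefl a<a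
<lex-irrefl (next u<u) = <lex-irrefl u<u

<lex-trans : ∀ {u v w} → u <lex v → v <lex w → u <lex w
<lex-trans halt (this _) = halt
<lex-trans halt (next _) = halt
<lex-trans (this a<b) (this b<c) = this (<L-trans a<b b<c)
<lex-trans (this a<b) (next _) = this a<b
<lex-trans (next _) (this b<c) = this b<c
<lex-trans (next u<v) (next v<w) = next (<lex-trans u<v v<w)

<lex-≤lex-trans : ∀ {u v w} → u <lex v → v ≤lex w → u <lex w
<lex-≤lex-trans u<v (inj₁ v<w) = <lex-trans u<v v<w
<lex-≤lex-trans u<v (inj₂ refl) = u<v

≤lex-<lex-trans : ∀ {u v w} → u ≤lex v → v <lex w → u <lex w
≤lex-<lex-trans (inj₁ u<v) v<w = <lex-trans u<v v<w
≤lex-<lex-trans (inj₂ refl) v<w = v<w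

<lex⇒≱lex : ∀ {u v} → u <lex v → ¬ (v ≤lex u)
<lex⇒≱lex u<v v≤u = <lex-irrefl (<lex-≤lex-trans u<v v≤u)

<lex-trichotomy : ∀ u v → u <lex v ⊎ u ≡ v ⊎ v <lex u
<lex-trichotomy [] [] = inj₂ (inj₁ refl)
<lex-trichotomy [] (_ ∷ _) = inj₁ halt
<lex-trichotomy (_ ∷ _) [] = inj₂ (inj₂ halt)
<lex-trichotomy (a ∷ u) (b ∷ v) with <L-trichotomy a b
... | inj₁ a<b = inj₁ (this a<b)
... | inj₂ (inj₂ b<a) = inj₂ (inj₂ (this b<a))
... | inj₂ (inj₁ refl) with <lex-trichotomy u v
...   | inj₁ u<v = inj₁ (next u<v)
...   | inj₂ (inj₁ refl) = inj₂ (inj₁ refl)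
...   | inj₂ (inj₂ v<u) = inj₂ (inj₂ (next v<u))

take-≤lex : ∀ n {u v} → u ≤lex v → take n u ≤lex take n v
take-≤lex n (inj₂ refl) = inj₂ refl
take-≤lex zero (inj₁ _) = inj₂ refl
take-≤lex (suc n) (inj₁ halt) = inj₁ halt
take-≤lex (suc n) (inj₁ (this a<b)) = inj₁ (this a<b)
take-≤lex (suc n) (inj₁ (next u<v)) with take-≤lex n (inj₁ u<v)
... | inj₁ r = inj₁ (next r)
... | inj₂ e = inj₂ (cong (_ ∷_) e)

∷ʳ-<lex⁺ : ∀ {p q : Word} {a b} → length p ≡ length q → p <lex q → (p ∷ʳ a) <lex (q ∷ʳ b)
∷ʳ-<lex⁺ () halt
∷ʳ-<lex⁺ _ (this a<b) = this a<b
∷ʳ-<lex⁺ e (next p<q) = next (∷ʳ-<lex⁺ (suc-injective e) p<q)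

∷ʳ-<lex⁺ʳ : ∀ {u : Word} {a b} → a <L b → (u ∷ʳ a) <lex (u ∷ʳ b)
∷ʳ-<lex⁺ʳ {[]} a<b = this a<b
∷ʳ-<lex⁺ʳ {_ ∷ u} a<b = next (∷ʳ-<lex⁺ʳ {u} a<b)

∷ʳ-<lex⁻ : ∀ {p q : Word} {a b} → length p ≡ length q →
           (p ∷ʳ a) <lex (q ∷ʳ b) → p <lex q ⊎ (p ≡ q × a <L b)
∷ʳ-<lex⁻ {[]} {[]} _ (this a<b) = inj₂ (refl , a<b)
∷ʳ-<lex⁻ {_ ∷ _} {_ ∷ _} _ (this c<d) = inj₁ (this c<d)
∷ʳ-<lex⁻ {_ ∷ p} {_ ∷ q} e (next r) with ∷ʳ-<lex⁻ {p} {q} (suc-injective e) r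
... | inj₁ p<q = inj₁ (next p<q)
... | inj₂ (refl , a<b) = inj₂ (refl , a<b)

∷ʳ-≤lex⁻ : ∀ {p q : Word} {a b} → length p ≡ length q →
           (p ∷ʳ a) ≤lex (q ∷ʳ b) → p <lex q ⊎ (p ≡ q × a ≤L b)
∷ʳ-≤lex⁻ e (inj₁ r) with ∷ʳ-<lex⁻ e r
... | inj₁ p<q = inj₁ p<q
... | inj₂ (p≡q , a<b) = inj₂ (p≡q , inj₁ a<b)
∷ʳ-≤lex⁻ {p} {q} _ (inj₂ r) = inj₂ (∷ʳ-injectiveˡ p q r , inj₂ (∷ʳ-injectiveʳ p q r))

∷ʳ-≤lex⇔ : ∀ {p q : Word} {a b} → length p ≡ length q → (p ≡ q → a ≡ b) →
           (p ∷ʳ a) ≤lex (q ∷ʳ b) ⇔ p ≤lex q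
∷ʳ-≤lex⇔ {p} {q} {a} {b} e same = mk⇔ to from
  where
  to : (p ∷ʳ a) ≤lex (q ∷ʳ b) → p ≤lex q
  to r with ∷ʳ-≤lex⁻ e r
  ... | inj₁ p<q = inj₁ p<q
  ... | inj₂ (p≡q , _) = inj₂ p≡q
  from : p ≤lex q → (p ∷ʳ a) ≤lex (q ∷ʳ b)
  from (inj₁ p<q) = inj₁ (∷ʳ-<lex⁺ e p<q)
  from (inj₂ refl) = inj₂ (cong (p ∷ʳ_) (same refl))

∷ʳ-≡⇔ : ∀ {p q : Word} {a b} → (p ≡ q → a ≡ b) → (p ∷ʳ a ≡ q ∷ʳ b) ⇔ (p ≡ q)
∷ʳ-≡⇔ {p} {q} same = mk⇔ (∷ʳ-injectiveˡ p q) λ { refl → cong (p ∷ʳ_) (same refl) }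

⊴-refl : ∀ {u} → u ⊴ u
⊴-refl = Pointwise.refl ≤L-refl

⊴-trans : ∀ {u v w} → u ⊴ v → v ⊴ w → u ⊴ w
⊴-trans = Pointwise.transitive ≤L-trans

_⊴?_ : ∀ u v → Dec (u ⊴ v)
_⊴?_ = Pointwise.decidable _≤L?_

⊴⇒≤lex : ∀ {u v} → u ⊴ v → u ≤lex v
⊴⇒≤lex [] = inj₂ refl
⊴⇒≤lex (inj₁ a<b ∷ _) = inj₁ (this a<b)
⊴⇒≤lex (inj₂ refl ∷ d) with ⊴⇒≤lex d
... | inj₁ u<v = inj₁ (next u<v)
... | inj₂ refl = inj₂ refl

⊴⇒≯lex : ∀ {u v} → u ⊴ v → ¬ (v <lex u)
⊴⇒≯lex d v<u = <lex⇒≱lex v<u (⊴⇒≤lex d)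

∷ʳ-⊴⇔ : ∀ {p q : Word} {a b} → length p ≡ length q →
        (p ∷ʳ a) ⊴ (q ∷ʳ b) ⇔ (p ⊴ q × a ≤L b)
∷ʳ-⊴⇔ e = mk⇔ (to e) λ (d , a≤b) → ++⁺ d (a≤b ∷ [])
  where
  to : ∀ {p q : Word} {a b} → length p ≡ length q → (p ∷ʳ a) ⊴ (q ∷ʳ b) → p ⊴ q × a ≤L b
  to {[]} {[]} _ (a≤b ∷ []) = [] , a≤b
  to {_ ∷ _} {_ ∷ _} e (c≤d ∷ r) = let (d , a≤b) = to (suc-injective e) r in c≤d ∷ d , a≤b

∷ʳ-⊴⇔⊴ : ∀ {p q : Word} {a b} → length p ≡ length q → (p ⊴ q → a ≤L b) →
         (p ∷ʳ a) ⊴ (q ∷ʳ b) ⇔ p ⊴ q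
∷ʳ-⊴⇔⊴ e mono = mk⇔ (proj₁ ∘ Equivalence.to (∷ʳ-⊴⇔ e)) λ d → Equivalence.from (∷ʳ-⊴⇔ e) (d , mono d)

_⊥?_ : ∀ u v → Dec (u ⊥w v)
u ⊥? v = ¬? (u ⊴? v) ×-dec ¬? (v ⊴? u)

⊥w-sym : ∀ {u v} → u ⊥w v → v ⊥w u
⊥w-sym = swap

∦-<lex⇒⊴ : ∀ {u v} → ¬ (u ⊥w v) → u <lex v → u ⊴ v
∦-<lex⇒⊴ {u} {v} u∦v u<v with u ⊴? v | v ⊴? u
... | yes u⊴v | _ = u⊴v
... | no _ | yes v⊴u = ⊥-elim (⊴⇒≯lex v⊴u u<v)
... | no u⋬v | no v⋬u = ⊥-elim (u∦v (u⋬v , v⋬u))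

unrelated⇒⊴ : ∀ {v w} → Unrelated v w → v <lex w → v ⊴ w
unrelated⇒⊴ unrelated = ∦-<lex⇒⊴ (unrelated ∘ inj₂ ∘ inj₂)

≺-irrefl : ∀ {u} → ¬ (u ≺ u)
≺-irrefl (there _ u≺u) = ≺-irrefl u≺u

≺-⊴-trans : ∀ {u v w} → u ≺ v → v ⊴ w → u ≺ w
≺-⊴-trans here (inj₂ refl ∷ _) = here
≺-⊴-trans (there a≤b u≺v) (b≤c ∷ d) = there (≤L-trans a≤b b≤c) (≺-⊴-trans u≺v d)

≺-⊴⇒<lex : ∀ {u v} → u ≺ v → u ⊴ v → u <lex v
≺-⊴⇒<lex u≺v d with ⊴⇒≤lex d
... | inj₁ u<v = u<v
... | inj₂ refl = ⊥-elim (≺-irrefl u≺v)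

∷ʳ-≺⁺ : ∀ {p q : Word} {a b} → p ≺ q → (p ∷ʳ a) ≺ (q ∷ʳ b)
∷ʳ-≺⁺ here = here
∷ʳ-≺⁺ (there c≤d p≺q) = there c≤d (∷ʳ-≺⁺ p≺q)

∷ʳ-≺-LR : ∀ {p q : Word} → p ⊴ q → (p ∷ʳ L) ≺ (q ∷ʳ R)
∷ʳ-≺-LR [] = here
∷ʳ-≺-LR (c≤d ∷ d) = there c≤d (∷ʳ-≺-LR d)

∷ʳ-≺⁻ : ∀ {p q : Word} {a b} → length p ≡ length q →
        (p ∷ʳ a) ≺ (q ∷ʳ b) → p ≺ q ⊎ (p ⊴ q × a ≡ L × b ≡ R)
∷ʳ-≺⁻ {[]} {[]} _ here = inj₂ ([] , refl , refl)
∷ʳ-≺⁻ {_ ∷ _} {_ ∷ _} _ here = inj₁ here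
∷ʳ-≺⁻ {_ ∷ p} {_ ∷ q} e (there c≤d r) with ∷ʳ-≺⁻ {p} {q} (suc-injective e) r
... | inj₁ p≺q = inj₁ (there c≤d p≺q)
... | inj₂ (d , a≡L , b≡R) = inj₂ (c≤d ∷ d , a≡L , b≡R)

∷ʳ-⪯⇔ : ∀ {p q : Word} {a b} → length p ≡ length q → a ≢ L → (p ≡ q → a ≡ b) →
        (p ∷ʳ a) ⪯ (q ∷ʳ b) ⇔ p ⪯ q
∷ʳ-⪯⇔ {p} {q} {a} {b} e a≢L same = mk⇔ to from
  where
  to : (p ∷ʳ a) ⪯ (q ∷ʳ b) → p ⪯ q
  to (inj₁ r) with ∷ʳ-≺⁻ e r
  ... | inj₁ p≺q = inj₁ p≺q
  ... | inj₂ (_ , a≡L , _) = ⊥-elim (a≢L a≡L)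
  to (inj₂ r) = inj₂ (Equivalence.to (∷ʳ-≡⇔ same) r)
  from : p ⪯ q → (p ∷ʳ a) ⪯ (q ∷ʳ b)
  from (inj₁ p≺q) = inj₁ (∷ʳ-≺⁺ p≺q)
  from (inj₂ p≡q) = inj₂ (Equivalence.from (∷ʳ-≡⇔ same) p≡q)

∷ʳ-⋠ : ∀ {u : Word} {a b} → a ≢ L → a ≢ b → ¬ ((u ∷ʳ a) ⪯ (u ∷ʳ b))
∷ʳ-⋠ a≢L a≢b (inj₁ r) with ∷ʳ-≺⁻ refl r
... | inj₁ u≺u = ≺-irrefl u≺u
... | inj₂ (_ , a≡L , _) = a≢L a≡L
∷ʳ-⋠ {u} _ a≢b (inj₂ r) = a≢b (∷ʳ-injectiveʳ u u r)

-- Compatibility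

zip-∷ʳ : ∀ {A B : Set} {xs : List A} {ys : List B} x y → length xs ≡ length ys →
         zip (xs ∷ʳ x) (ys ∷ʳ y) ≡ zip xs ys ∷ʳ (x , y)
zip-∷ʳ {xs = []} {[]} _ _ _ = refl
zip-∷ʳ {xs = c ∷ _} {d ∷ _} x y e = cong ((c , d) ∷_) (zip-∷ʳ x y (suc-injective e))

zip-take-⊓ : ∀ {A B : Set} (xs : List A) (ys : List B) →
             zip xs ys ≡ zip (take (length xs ⊓ length ys) xs) (take (length xs ⊓ length ys) ys)
zip-take-⊓ [] _ = refl
zip-take-⊓ (_ ∷ _) [] = refl
zip-take-⊓ (x ∷ xs) (y ∷ ys) = cong ((x , y) ∷_) (zip-take-⊓ xs ys)

All-≤L⇒⊴ : ∀ {u v} → length u ≡ length v → All (λ p → proj₁ p ≤L proj₂ p) (zip u v) → u ⊴ v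
All-≤L⇒⊴ {[]} {[]} _ [] = []
All-≤L⇒⊴ {_ ∷ _} {_ ∷ _} e (a≤b ∷ all) = a≤b ∷ All-≤L⇒⊴ (suc-injective e) all

⊴⇒All-≤L : ∀ {u v} → u ⊴ v → All (λ p → proj₁ p ≤L proj₂ p) (zip u v)
⊴⇒All-≤L [] = []
⊴⇒All-≤L (a≤b ∷ d) = a≤b ∷ ⊴⇒All-≤L d

LR∈zip⇒≺ : ∀ {u v} → (L , R) ∈ zip u v → u ⊴ v → u ≺ v
LR∈zip⇒≺ {_ ∷ _} {_ ∷ _} (here refl) _ = here
LR∈zip⇒≺ {_ ∷ _} {_ ∷ _} (there m) (a≤b ∷ d) = there a≤b (LR∈zip⇒≺ m d)

∈-zip-diagonal : ∀ {a b} (u : Word) → (a , b) ∈ zip u u → a ≡ b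
∈-zip-diagonal (_ ∷ _) (here refl) = refl
∈-zip-diagonal (_ ∷ u) (there m) = ∈-zip-diagonal u m

compatible-refl : ∀ u → Compatible u u
compatible-refl u = (λ m → R≢L (∈-zip-diagonal u m)) , λ _ → ⊴⇒All-≤L ⊴-refl
  where
  R≢L : R ≢ L
  R≢L ()

-- Compatible u v unfolds to CompatiblePairs (zip u v).
CompatiblePairs : List (Letter × Letter) → Set
CompatiblePairs Z = ¬ ((R , L) ∈ Z) × ((L , R) ∈ Z → All (λ c → proj₁ c ≤L proj₂ c) Z)

∷ʳ-compatible : ∀ {p q : Word} {a b} → length p ≡ length q → Compatible p q →
                (a ≡ R → b ≡ L → ⊥) → (a ≡ L → b ≡ R → p ⊴ q) → (p ≺ q → p ⊴ q → a ≤L b) →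
                Compatible (p ∷ʳ a) (q ∷ʳ b)
∷ʳ-compatible {p} {q} {a} {b} e (no-RL , LR⇒≤) not-RL LR⇒⊴ ≺⇒≤ =
  subst CompatiblePairs (sym (zip-∷ʳ a b e)) (no-RL′ , LR⇒≤′)
  where
  no-RL′ : ¬ ((R , L) ∈ zip p q ∷ʳ (a , b))
  no-RL′ m with ∈-++⁻ (zip p q) m
  ... | inj₁ m′ = no-RL m′
  ... | inj₂ (here refl) = not-RL refl refl
  LR⇒≤′ : (L , R) ∈ zip p q ∷ʳ (a , b) → All (λ c → proj₁ c ≤L proj₂ c) (zip p q ∷ʳ (a , b))
  LR⇒≤′ m with ∈-++⁻ (zip p q) m
  ... | inj₁ m′ = let d = All-≤L⇒⊴ e (LR⇒≤ m′) in ∷ʳ⁺ (LR⇒≤ m′) (≺⇒≤ (LR∈zip⇒≺ m′ d) d)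
  ... | inj₂ (here refl) = ∷ʳ⁺ (⊴⇒All-≤L (LR⇒⊴ refl refl)) (inj₁ L<R)

compatible-truncate : ∀ u v → let n = length u ⊓ length v in
                      Compatible (take n u) (take n v) → Compatible u v
compatible-truncate u v =
  subst CompatiblePairs (sym (zip-take-⊓ u v))

-- Levels obtained by appending one letter

take-∷ʳ : ∀ {A : Set} (u : List A) a → take (length u) (u ∷ʳ a) ≡ u
take-∷ʳ [] _ = refl
take-∷ʳ (c ∷ u) a = cong (c ∷_) (take-∷ʳ u a)

Extends : (Word → Set) → ℕ → (Word → Letter → Set) → Set
Extends S ℓ Tail = ∀ z → SbarAt S (suc ℓ) z ⇔
  (Σ Word λ u → SbarAt S ℓ u × Σ Letter λ a → Tail u a × z ≡ u ∷ʳ a)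

extends-via : ∀ {S ℓ} {Next : Word → Word → Set} {Tail : Word → Letter → Set} →
              (∀ {u z} → Next u z ⇔ (Σ Letter λ a → Tail u a × z ≡ u ∷ʳ a)) →
              (∀ z → SbarAt S (suc ℓ) z ⇔ (Σ Word λ u → SbarAt S ℓ u × Next u z)) →
              Extends S ℓ Tail
extends-via shape grow = λ z → mk⇔
  (map₂ (map₂ (Equivalence.to shape)) ∘ Equivalence.to (grow z))
  (Equivalence.from (grow z) ∘ map₂ (map₂ (Equivalence.from shape)))

CompatibleLevel : (Word → Set) → ℕ → Set
CompatibleLevel S ℓ = ∀ u v → SbarAt S ℓ u → SbarAt S ℓ v → u ≤lex v → Compatible u v

module Extension {S : Word → Set} {ℓ : ℕ} {Tail : Word → Letter → Set} (extends : Extends S ℓ Tail) where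

  same-length : ∀ {p q} → SbarAt S ℓ p → SbarAt S ℓ q → length p ≡ length q
  same-length (_ , p≡ℓ) (_ , q≡ℓ) = trans p≡ℓ (sym q≡ℓ)

  ρ-∷ʳ : ∀ {u a} → SbarAt S ℓ u → ρ ℓ (u ∷ʳ a) ≡ u
  ρ-∷ʳ {u} {a} (_ , refl) = take-∷ʳ u a

  ∷ʳ-next : ∀ {u a} → SbarAt S ℓ u → Tail u a → SbarAt S (suc ℓ) (u ∷ʳ a)
  ∷ʳ-next su tail = Equivalence.from (extends _) (_ , su , _ , tail , refl)

  ρ-elim : (Q : Word → Word → Set) →
           (∀ {u a} → SbarAt S ℓ u → Tail u a → Q (u ∷ʳ a) u) →
           ∀ z → SbarAt S (suc ℓ) z → Q z (ρ ℓ z)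
  ρ-elim Q h z sz with Equivalence.to (extends z) sz
  ... | _ , su , a , tail , refl rewrite ρ-∷ʳ {a = a} su = h su tail

  ρ-elim₂ : (Q : Word → Word → Word → Word → Set) →
            (∀ {p q a b} → SbarAt S ℓ p → SbarAt S ℓ q → Tail p a → Tail q b → Q (p ∷ʳ a) (q ∷ʳ b) p q) →
            ∀ z z' → SbarAt S (suc ℓ) z → SbarAt S (suc ℓ) z' → Q z z' (ρ ℓ z) (ρ ℓ z')
  ρ-elim₂ Q h z z' sz sz' with Equivalence.to (extends z) sz | Equivalence.to (extends z') sz'
  ... | _ , sp , a , tp , refl | _ , sq , b , tq , refl
    rewrite ρ-∷ʳ {a = a} sp | ρ-∷ʳ {a = b} sq = h sp sq tp tq

  ρ-preserves : (Rel : Word → Word → Set) →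
                (∀ {p q a b} → SbarAt S ℓ p → SbarAt S ℓ q → Tail p a → Tail q b →
                   Rel (p ∷ʳ a) (q ∷ʳ b) ⇔ Rel p q) →
                Preserves S ℓ Rel
  ρ-preserves Rel = ρ-elim₂ (λ z z' x y → Rel z z' ⇔ Rel x y)

  Functional : Set
  Functional = ∀ {u a b} → SbarAt S ℓ u → Tail u a → Tail u b → a ≡ b

  ρ-onto : (T : Word → Set) → (∀ {u} → T u → SbarAt S ℓ u × Σ Letter (Tail u)) →
           ∀ u → T u → Σ Word λ z → SbarAt S (suc ℓ) z × ρ ℓ z ≡ u
  ρ-onto T onto u t = let (su , a , tail) = onto t in u ∷ʳ a , ∷ʳ-next su tail , ρ-∷ʳ su

  ρ-bijOnto : (T : Word → Set) → Functional →
              (∀ {u a} → SbarAt S ℓ u → Tail u a → T u) →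
              (∀ {u} → T u → SbarAt S ℓ u × Σ Letter (Tail u)) →
              BijOnto S ℓ T
  ρ-bijOnto T functional into onto =
    ρ-elim (λ _ u → T u) into ,
    ρ-elim₂ (λ z z' p q → p ≡ q → z ≡ z') (λ sp _ tp tq → λ { refl → cong (_ ∷ʳ_) (functional sp tp tq) }) ,
    ρ-onto T onto

  ρ-bijective : Functional → (∀ {u} → SbarAt S ℓ u → Σ Letter (Tail u)) → BijOnto S ℓ (SbarAt S ℓ)
  ρ-bijective functional total = ρ-bijOnto (SbarAt S ℓ) functional (λ su _ → su) (λ su → su , total su)

  ρ-preserves-≤lex : Functional → Preserves S ℓ _≤lex_
  ρ-preserves-≤lex functional = ρ-preserves _≤lex_ λ sp sq tp tq →
    ∷ʳ-≤lex⇔ (same-length sp sq) λ { refl → functional sp tp tq }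

  ρ-preserves-⪯ : Functional → (∀ {u} → ¬ Tail u L) → Preserves S ℓ _⪯_
  ρ-preserves-⪯ functional no-L = ρ-preserves _⪯_ λ sp sq tp tq →
    ∷ʳ-⪯⇔ (same-length sp sq) (λ { refl → no-L tp }) λ { refl → functional sp tp tq }

  ρ-preserves-⊴ : (∀ {p q a b} → SbarAt S ℓ p → SbarAt S ℓ q → p ⊴ q → Tail p a → Tail q b → a ≤L b) →
                  Preserves S ℓ _⊴_
  ρ-preserves-⊴ monotone = ρ-preserves _⊴_ λ sp sq tp tq →
    ∷ʳ-⊴⇔⊴ (same-length sp sq) λ d → monotone sp sq d tp tq

  compatible-step :
    (∀ {p q} → SbarAt S ℓ p → SbarAt S ℓ q → p <lex q → Tail p R → Tail q L → ⊥) →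
    (∀ {p q} → SbarAt S ℓ p → SbarAt S ℓ q → p <lex q → Tail p L → Tail q R → p ⊴ q) →
    (∀ {p q a b} → SbarAt S ℓ p → SbarAt S ℓ q → p ≺ q → p ⊴ q → Tail p a → Tail q b → a ≤L b) →
    CompatibleLevel S ℓ → CompatibleLevel S (suc ℓ)
  compatible-step no-RL LR⇒⊴ ≺⇒≤ compatible =
    ρ-elim₂ (λ z z' _ _ → z ≤lex z' → Compatible z z') step
    where
    step : ∀ {p q a b} → SbarAt S ℓ p → SbarAt S ℓ q → Tail p a → Tail q b →
           (p ∷ʳ a) ≤lex (q ∷ʳ b) → Compatible (p ∷ʳ a) (q ∷ʳ b)
    step sp sq tp tq le with ∷ʳ-≤lex⁻ (same-length sp sq) le
    ... | inj₁ p<q =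
      ∷ʳ-compatible (same-length sp sq) (compatible _ _ sp sq (inj₁ p<q))
        (λ { refl refl → no-RL sp sq p<q tp tq })
        (λ { refl refl → LR⇒⊴ sp sq p<q tp tq })
        (λ p≺q d → ≺⇒≤ sp sq p≺q d tp tq)
    ... | inj₂ (refl , a≤b) =
      ∷ʳ-compatible refl (compatible-refl _) (λ { refl refl → <L⇒≱L L<R a≤b })
        (λ _ _ → ⊴-refl) (λ p≺p _ → ⊥-elim (≺-irrefl p≺p))

-- Leaf levels

data LeafTail (w : Word) : Word → Letter → Set where
  kept : ∀ {u} → u ≢ w → LeafTail w u X

module Leaf {S : Word → Set} {ℓ : ℕ} {w : Word} (H : LeafAt S ℓ w) where

  extends : Extends S ℓ (LeafTail w)
  extends = extends-via shape (proj₂ (proj₂ H))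
    where
    shape : ∀ {u z} → (u ≢ w × z ≡ u ∷ʳ X) ⇔ (Σ Letter λ a → LeafTail w u a × z ≡ u ∷ʳ a)
    shape = mk⇔ (λ (u≢w , e) → X , kept u≢w , e) λ { (X , kept u≢w , e) → u≢w , e }

  open Extension extends hiding (compatible-step)

  functional : Functional
  functional _ (kept _) (kept _) = refl

  conclusion : LeafConcl S ℓ w
  conclusion =
    ρ-bijOnto _ functional (λ { su (kept u≢w) → su , u≢w }) (λ (su , u≢w) → su , X , kept u≢w) ,
    ρ-preserves-≤lex functional ,
    ρ-preserves-⪯ functional (λ ()) ,
    ρ-preserves-⊴ λ { _ _ _ (kept _) (kept _) → ≤L-refl }

  compatible-step : CompatibleLevel S ℓ → CompatibleLevel S (suc ℓ)
  compatible-step = Extension.compatible-step extends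
    (λ _ _ _ _ ()) (λ _ _ _ ()) λ { _ _ _ _ (kept _) (kept _) → ≤L-refl }

-- Splitting levels

data SplitTail (w : Word) : Word → Letter → Set where
  left  : ∀ {u} → u <lex w → SplitTail w u X
  copyX : SplitTail w w X
  copyR : SplitTail w w R
  right : ∀ {u} → w <lex u → SplitTail w u R

module Split {S : Word → Set} {ℓ : ℕ} {w : Word} (H : SplitAt S ℓ w) where

  extends : Extends S ℓ (SplitTail w)
  extends = extends-via (mk⇔ to from) (proj₂ H)
    where
    to : ∀ {u z} → (u <lex w × z ≡ u ∷ʳ X) ⊎ (u ≡ w × (z ≡ w ∷ʳ X ⊎ z ≡ w ∷ʳ R)) ⊎ (w <lex u × z ≡ u ∷ʳ R) →
         Σ Letter λ a → SplitTail w u a × z ≡ u ∷ʳ a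
    to (inj₁ (u<w , e)) = X , left u<w , e
    to (inj₂ (inj₁ (refl , inj₁ e))) = X , copyX , e
    to (inj₂ (inj₁ (refl , inj₂ e))) = R , copyR , e
    to (inj₂ (inj₂ (w<u , e))) = R , right w<u , e
    from : ∀ {u z} → (Σ Letter λ a → SplitTail w u a × z ≡ u ∷ʳ a) →
           (u <lex w × z ≡ u ∷ʳ X) ⊎ (u ≡ w × (z ≡ w ∷ʳ X ⊎ z ≡ w ∷ʳ R)) ⊎ (w <lex u × z ≡ u ∷ʳ R)
    from (X , left u<w , e) = inj₁ (u<w , e)
    from (X , copyX , e) = inj₂ (inj₁ (refl , inj₁ e))
    from (R , copyR , e) = inj₂ (inj₁ (refl , inj₂ e))
    from (R , right w<u , e) = inj₂ (inj₂ (w<u , e))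

  open Extension extends hiding (compatible-step)

  total : ∀ u → Σ Letter (SplitTail w u)
  total u with <lex-trichotomy u w
  ... | inj₁ u<w = X , left u<w
  ... | inj₂ (inj₁ refl) = X , copyX
  ... | inj₂ (inj₂ w<u) = R , right w<u

  functional-off-w : ∀ {u a b} → u ≢ w → SplitTail w u a → SplitTail w u b → a ≡ b
  functional-off-w u≢w copyX _ = ⊥-elim (u≢w refl)
  functional-off-w u≢w copyR _ = ⊥-elim (u≢w refl)
  functional-off-w u≢w _ copyX = ⊥-elim (u≢w refl)
  functional-off-w u≢w _ copyR = ⊥-elim (u≢w refl)
  functional-off-w _ (left _) (left _) = refl
  functional-off-w _ (right _) (right _) = refl
  functional-off-w _ (left u<w) (right w<u) = ⊥-elim (<lex-irrefl (<lex-trans u<w w<u))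
  functional-off-w _ (right w<u) (left u<w) = ⊥-elim (<lex-irrefl (<lex-trans u<w w<u))

  X-tail⇒≤ : ∀ {u} → SplitTail w u X → u ≤lex w
  X-tail⇒≤ (left u<w) = inj₁ u<w
  X-tail⇒≤ copyX = inj₂ refl

  R-tail⇒≥ : ∀ {u} → SplitTail w u R → w ≤lex u
  R-tail⇒≥ copyR = inj₂ refl
  R-tail⇒≥ (right w<u) = inj₁ w<u

  monotone : ∀ {p q a b} → p <lex q → SplitTail w p a → SplitTail w q b → a ≤L b
  monotone {a = X} {b = X} _ _ _ = ≤L-refl
  monotone {a = X} {b = R} _ _ _ = inj₁ X<R
  monotone {a = R} {b = R} _ _ _ = ≤L-refl
  monotone {a = R} {b = X} p<q tp tq =
    ⊥-elim (<lex-irrefl (≤lex-<lex-trans (R-tail⇒≥ tp) (<lex-≤lex-trans p<q (X-tail⇒≤ tq))))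
  monotone {a = L} _ () _
  monotone {b = L} _ _ ()

  monotone-⊴ : ∀ {p q a b} → p ≢ q → p ⊴ q → SplitTail w p a → SplitTail w q b → a ≤L b
  monotone-⊴ p≢q d with ⊴⇒≤lex d
  ... | inj₁ p<q = monotone p<q
  ... | inj₂ p≡q = ⊥-elim (p≢q p≡q)

  fibre-of-w : ∀ {u a} → SplitTail w u a → u ≡ w → u ∷ʳ a ≡ w ∷ʳ X ⊎ u ∷ʳ a ≡ w ∷ʳ R
  fibre-of-w (left u<w) refl = ⊥-elim (<lex-irrefl u<w)
  fibre-of-w copyX _ = inj₁ refl
  fibre-of-w copyR _ = inj₂ refl
  fibre-of-w (right w<u) refl = ⊥-elim (<lex-irrefl w<u)

  no-L : ∀ {u} → ¬ SplitTail w u L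
  no-L ()

  conclusion : SplitConcl S ℓ w
  conclusion =
    ρ-elim (λ _ u → SbarAt S ℓ u) (λ su _ → su) ,
    ρ-onto (SbarAt S ℓ) (λ {u} su → su , total u) ,
    ∷ʳ-next sw copyX , ∷ʳ-next sw copyR , ρ-∷ʳ sw , ρ-∷ʳ sw ,
    ρ-elim (λ z u → u ≡ w → z ≡ w ∷ʳ X ⊎ z ≡ w ∷ʳ R) (λ _ → fibre-of-w) ,
    ρ-elim₂ (λ z z' p q → p ≡ q → p ≢ w → z ≡ z')
      (λ _ _ tp tq → λ { refl p≢w → cong (_ ∷ʳ_) (functional-off-w p≢w tp tq) }) ,
    ρ-elim₂ (λ z z' p q → p ≢ q → (z ≤lex z' ⇔ p ≤lex q) × (z ⪯ z' ⇔ p ⪯ q) × (z ⊴ z' ⇔ p ⊴ q))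
      (λ sp sq tp tq p≢q →
        ∷ʳ-≤lex⇔ (same-length sp sq) (⊥-elim ∘ p≢q) ,
        ∷ʳ-⪯⇔ (same-length sp sq) (λ { refl → no-L tp }) (⊥-elim ∘ p≢q) ,
        ∷ʳ-⊴⇔⊴ (same-length sp sq) λ d → monotone-⊴ p≢q d tp tq) ,
    ∷ʳ-<lex⁺ʳ X<R , ∷ʳ-⋠ (λ ()) (λ ()) , ∷ʳ-⋠ (λ ()) (λ ()) ,
    Equivalence.from (∷ʳ-⊴⇔ refl) (⊴-refl , inj₁ X<R)
    where
    sw : SbarAt S ℓ w
    sw = proj₁ H

  compatible-step : CompatibleLevel S ℓ → CompatibleLevel S (suc ℓ)
  compatible-step = Extension.compatible-step extends
    (λ _ _ _ _ ()) (λ _ _ _ ()) λ _ _ p≺q d → monotone (≺-⊴⇒<lex p≺q d)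

-- New ⊥ levels

data PerpTail (v w : Word) : Word → Letter → Set where
  before    : ∀ {u} → u <lex v → PerpTail v w u X
  at-v      : PerpTail v w v R
  between-⊥ : ∀ {u} → v <lex u → u <lex w → u ⊥w v → PerpTail v w u X
  between-∦ : ∀ {u} → v <lex u → u <lex w → ¬ (u ⊥w v) → PerpTail v w u R
  at-w      : PerpTail v w w X
  after     : ∀ {u} → w <lex u → PerpTail v w u R

module NewPerp {S : Word → Set} {ℓ : ℕ} {v w : Word} (H : NewPerpAt S ℓ v w) where

  private
    sv : SbarAt S ℓ v
    sv = proj₁ H
    sw : SbarAt S ℓ w
    sw = proj₁ (proj₂ H)
    v<w : v <lex w
    v<w = proj₁ (proj₂ (proj₂ H))
    unrelated : Unrelated v w
    unrelated = proj₁ (proj₂ (proj₂ (proj₂ H)))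
    between : ∀ u → SbarAt S ℓ u → v <lex u → u <lex w → u ⊥w v ⊎ u ⊥w w
    between = proj₁ (proj₂ (proj₂ (proj₂ (proj₂ H))))

  extends : Extends S ℓ (PerpTail v w)
  extends = extends-via (mk⇔ to from) (proj₂ (proj₂ (proj₂ (proj₂ (proj₂ H)))))
    where
    to : ∀ {u z} →
         (u <lex v × z ≡ u ∷ʳ X) ⊎ (u ≡ v × z ≡ v ∷ʳ R)
         ⊎ (v <lex u × u <lex w × u ⊥w v × z ≡ u ∷ʳ X)
         ⊎ (v <lex u × u <lex w × ¬ (u ⊥w v) × z ≡ u ∷ʳ R)
         ⊎ (u ≡ w × z ≡ w ∷ʳ X) ⊎ (w <lex u × z ≡ u ∷ʳ R) →
         Σ Letter λ a → PerpTail v w u a × z ≡ u ∷ʳ a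
    to (inj₁ (u<v , e)) = X , before u<v , e
    to (inj₂ (inj₁ (refl , e))) = R , at-v , e
    to (inj₂ (inj₂ (inj₁ (v<u , u<w , u⊥v , e)))) = X , between-⊥ v<u u<w u⊥v , e
    to (inj₂ (inj₂ (inj₂ (inj₁ (v<u , u<w , u∦v , e))))) = R , between-∦ v<u u<w u∦v , e
    to (inj₂ (inj₂ (inj₂ (inj₂ (inj₁ (refl , e)))))) = X , at-w , e
    to (inj₂ (inj₂ (inj₂ (inj₂ (inj₂ (w<u , e)))))) = R , after w<u , e
    from : ∀ {u z} → (Σ Letter λ a → PerpTail v w u a × z ≡ u ∷ʳ a) →
           (u <lex v × z ≡ u ∷ʳ X) ⊎ (u ≡ v × z ≡ v ∷ʳ R)
           ⊎ (v <lex u × u <lex w × u ⊥w v × z ≡ u ∷ʳ X)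
           ⊎ (v <lex u × u <lex w × ¬ (u ⊥w v) × z ≡ u ∷ʳ R)
           ⊎ (u ≡ w × z ≡ w ∷ʳ X) ⊎ (w <lex u × z ≡ u ∷ʳ R)
    from (_ , before u<v , e) = inj₁ (u<v , e)
    from (_ , at-v , e) = inj₂ (inj₁ (refl , e))
    from (_ , between-⊥ v<u u<w u⊥v , e) = inj₂ (inj₂ (inj₁ (v<u , u<w , u⊥v , e)))
    from (_ , between-∦ v<u u<w u∦v , e) = inj₂ (inj₂ (inj₂ (inj₁ (v<u , u<w , u∦v , e))))
    from (_ , at-w , e) = inj₂ (inj₂ (inj₂ (inj₂ (inj₁ (refl , e)))))
    from (_ , after w<u , e) = inj₂ (inj₂ (inj₂ (inj₂ (inj₂ (w<u , e)))))

  open Extension extends hiding (compatible-step)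

  total : ∀ u → Σ Letter (PerpTail v w u)
  total u with <lex-trichotomy u v
  ... | inj₁ u<v = X , before u<v
  ... | inj₂ (inj₁ refl) = R , at-v
  ... | inj₂ (inj₂ v<u) with <lex-trichotomy u w
  ...   | inj₂ (inj₁ refl) = X , at-w
  ...   | inj₂ (inj₂ w<u) = R , after w<u
  ...   | inj₁ u<w with u ⊥? v
  ...     | yes u⊥v = X , between-⊥ v<u u<w u⊥v
  ...     | no u∦v = R , between-∦ v<u u<w u∦v

  v⊴w : v ⊴ w
  v⊴w = unrelated⇒⊴ unrelated v<w

  between-∦-facts : ∀ {u} → SbarAt S ℓ u → v <lex u → u <lex w → ¬ (u ⊥w v) → v ⊴ u × u ⊥w w
  between-∦-facts su v<u u<w u∦v with between _ su v<u u<w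
  ... | inj₁ u⊥v = ⊥-elim (u∦v u⊥v)
  ... | inj₂ u⊥w = ∦-<lex⇒⊴ (u∦v ∘ ⊥w-sym) v<u , u⊥w

  descent-only-at-vw : ∀ {p q} → SbarAt S ℓ p → p ⊴ q → PerpTail v w p R → PerpTail v w q X → p ≡ v × q ≡ w
  descent-only-at-vw _ d at-v (before q<v) = ⊥-elim (⊴⇒≯lex d q<v)
  descent-only-at-vw _ d at-v (between-⊥ _ _ q⊥v) = ⊥-elim (proj₂ q⊥v d)
  descent-only-at-vw _ _ at-v at-w = refl , refl
  descent-only-at-vw sp d (between-∦ v<p p<w p∦v) tq with between-∦-facts sp v<p p<w p∦v
  descent-only-at-vw _ d (between-∦ v<p _ _) (before q<v) | _ = ⊥-elim (⊴⇒≯lex d (<lex-trans q<v v<p))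
  descent-only-at-vw _ d (between-∦ _ _ _) (between-⊥ _ _ q⊥v) | v⊴p , _ = ⊥-elim (proj₂ q⊥v (⊴-trans v⊴p d))
  descent-only-at-vw _ d (between-∦ _ _ _) at-w | _ , p⊥w = ⊥-elim (proj₁ p⊥w d)
  descent-only-at-vw _ d (after w<p) (before q<v) = ⊥-elim (⊴⇒≯lex d (<lex-trans q<v (<lex-trans v<w w<p)))
  descent-only-at-vw _ d (after w<p) (between-⊥ _ q<w _) = ⊥-elim (⊴⇒≯lex d (<lex-trans q<w w<p))
  descent-only-at-vw _ d (after w<p) at-w = ⊥-elim (⊴⇒≯lex d w<p)

  monotone : ∀ {p q a b} → SbarAt S ℓ p → p ⊴ q → ¬ (p ≡ v × q ≡ w) →
             PerpTail v w p a → PerpTail v w q b → a ≤L b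
  monotone {a = X} {b = X} _ _ _ _ _ = ≤L-refl
  monotone {a = X} {b = R} _ _ _ _ _ = inj₁ X<R
  monotone {a = R} {b = R} _ _ _ _ _ = ≤L-refl
  monotone {a = R} {b = X} sp d not-vw tp tq = ⊥-elim (not-vw (descent-only-at-vw sp d tp tq))
  monotone {a = L} _ _ _ () _
  monotone {b = L} _ _ _ _ ()

  functional : Functional
  functional su ta tb = ≤L-antisym (monotone su ⊴-refl v≠w ta tb) (monotone su ⊴-refl v≠w tb ta)
    where
    v≠w : ¬ (_ ≡ v × _ ≡ w)
    v≠w (refl , refl) = <lex-irrefl v<w

  ∷ʳ-⊴⇔⊴-except-vw : ∀ {p q a b} → SbarAt S ℓ p → SbarAt S ℓ q → PerpTail v w p a → PerpTail v w q b →
          (p ∷ʳ a) ⊴ (q ∷ʳ b) ⇔ (p ⊴ q × ¬ (p ≡ v × q ≡ w))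
  ∷ʳ-⊴⇔⊴-except-vw sp sq tp tq = mk⇔
    (λ r → let (d , a≤b) = Equivalence.to (∷ʳ-⊴⇔ (same-length sp sq)) r in
       d , λ { (refl , refl) →
         <L⇒≱L X<R (subst₂ _≤L_ (functional sp tp at-v) (functional sq tq at-w) a≤b) })
    (λ (d , not-vw) → Equivalence.from (∷ʳ-⊴⇔ (same-length sp sq)) (d , monotone sp d not-vw tp tq))

  ∷ʳ-◁⇔ : ∀ {p q a b} → SbarAt S ℓ p → SbarAt S ℓ q → PerpTail v w p a → PerpTail v w q b →
          (p ∷ʳ a) ◁ (q ∷ʳ b) ⇔ (p ◁ q × ¬ (p ≡ v × q ≡ w))
  ∷ʳ-◁⇔ {p} {q} {a} {b} sp sq tp tq = mk⇔
    (λ (r , z≢z') → let (d , not-vw) = Equivalence.to ⊴⇔ r in (d , z≢z' ∘ Equivalence.from ≡⇔) , not-vw)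
    (λ ((d , p≢q) , not-vw) → Equivalence.from ⊴⇔ (d , not-vw) , p≢q ∘ Equivalence.to ≡⇔)
    where
    ⊴⇔ : (p ∷ʳ a) ⊴ (q ∷ʳ b) ⇔ (p ⊴ q × ¬ (p ≡ v × q ≡ w))
    ⊴⇔ = ∷ʳ-⊴⇔⊴-except-vw sp sq tp tq
    ≡⇔ : (p ∷ʳ a ≡ q ∷ʳ b) ⇔ (p ≡ q)
    ≡⇔ = ∷ʳ-≡⇔ λ { refl → functional sp tp tq }

  ∷ʳ-⊥⇔ : ∀ {p q a b} → SbarAt S ℓ p → SbarAt S ℓ q → PerpTail v w p a → PerpTail v w q b →
          (p ∷ʳ a) ⊥w (q ∷ʳ b) ⇔ (p ⊥w q ⊎ (p ≡ v × q ≡ w) ⊎ (p ≡ w × q ≡ v))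
  ∷ʳ-⊥⇔ {p} {q} {a} {b} sp sq tp tq = mk⇔ to from
    where
    ⊴⇔ : (p ∷ʳ a) ⊴ (q ∷ʳ b) ⇔ (p ⊴ q × ¬ (p ≡ v × q ≡ w))
    ⊴⇔ = ∷ʳ-⊴⇔⊴-except-vw sp sq tp tq
    ⊵⇔ : (q ∷ʳ b) ⊴ (p ∷ʳ a) ⇔ (q ⊴ p × ¬ (q ≡ v × p ≡ w))
    ⊵⇔ = ∷ʳ-⊴⇔⊴-except-vw sq sp tq tp
    to : (p ∷ʳ a) ⊥w (q ∷ʳ b) → p ⊥w q ⊎ (p ≡ v × q ≡ w) ⊎ (p ≡ w × q ≡ v)
    to (z⋬z' , z'⋬z) with (p ≟W v) ×-dec (q ≟W w) | (p ≟W w) ×-dec (q ≟W v)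
    ... | yes vw | _ = inj₂ (inj₁ vw)
    ... | no _ | yes wv = inj₂ (inj₂ wv)
    ... | no not-vw | no not-wv =
      inj₁ ((λ d → z⋬z' (Equivalence.from ⊴⇔ (d , not-vw))) ,
            (λ d → z'⋬z (Equivalence.from ⊵⇔ (d , not-wv ∘ swap))))
    from : p ⊥w q ⊎ (p ≡ v × q ≡ w) ⊎ (p ≡ w × q ≡ v) → (p ∷ʳ a) ⊥w (q ∷ʳ b)
    from (inj₁ (p⋬q , q⋬p)) = p⋬q ∘ proj₁ ∘ Equivalence.to ⊴⇔ , q⋬p ∘ proj₁ ∘ Equivalence.to ⊵⇔
    from (inj₂ (inj₁ (refl , refl))) =
      (λ r → proj₂ (Equivalence.to ⊴⇔ r) (refl , refl)) ,
      (λ r → ⊴⇒≯lex (proj₁ (Equivalence.to ⊵⇔ r)) v<w)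
    from (inj₂ (inj₂ (refl , refl))) =
      (λ r → ⊴⇒≯lex (proj₁ (Equivalence.to ⊴⇔ r)) v<w) ,
      (λ r → proj₂ (Equivalence.to ⊵⇔ r) (refl , refl))

  conclusion : NewPerpConcl S ℓ
  conclusion =
    ρ-bijective functional (λ {u} _ → total u) ,
    ρ-preserves-≤lex functional ,
    ρ-preserves-⪯ functional (λ ()) ,
    v , w , sv , sw , (v⊴w , λ { refl → <lex-irrefl v<w }) ,
    ρ-elim₂ (λ z z' p q → (z ◁ z' ⇔ (p ◁ q × ¬ (p ≡ v × q ≡ w)))
                          × (z ⊥w z' ⇔ (p ⊥w q ⊎ (p ≡ v × q ≡ w) ⊎ (p ≡ w × q ≡ v))))
      (λ sp sq tp tq → ∷ʳ-◁⇔ sp sq tp tq , ∷ʳ-⊥⇔ sp sq tp tq)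

  compatible-step : CompatibleLevel S ℓ → CompatibleLevel S (suc ℓ)
  compatible-step = Extension.compatible-step extends
    (λ _ _ _ _ ()) (λ _ _ _ ())
    λ sp _ p≺q d → monotone sp d λ { (refl , refl) → unrelated (inj₁ (inj₁ p≺q)) }

-- New ≺ levels

data PrecTail (v w : Word) : Word → Letter → Set where
  before-⊥ : ∀ {u} → u <lex v → u ⊥w v → PrecTail v w u X
  before-∦ : ∀ {u} → u <lex v → ¬ (u ⊥w v) → PrecTail v w u L
  at-v     : PrecTail v w v L
  between  : ∀ {u} → v <lex u → u <lex w → PrecTail v w u X
  at-w     : PrecTail v w w R
  after-⊥  : ∀ {u} → w <lex u → w ⊥w u → PrecTail v w u X
  after-∦  : ∀ {u} → w <lex u → ¬ (w ⊥w u) → PrecTail v w u R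

module NewPrec {S : Word → Set} {ℓ : ℕ} {v w : Word} (H : NewPrecAt S ℓ v w) where

  private
    sv : SbarAt S ℓ v
    sv = proj₁ H
    sw : SbarAt S ℓ w
    sw = proj₁ (proj₂ H)
    v<w : v <lex w
    v<w = proj₁ (proj₂ (proj₂ H))
    unrelated : Unrelated v w
    unrelated = proj₁ (proj₂ (proj₂ (proj₂ H)))
    below-v : ∀ u → SbarAt S ℓ u → u <lex v → u ⪯ w ⊎ u ⊥w v
    below-v = proj₁ (proj₂ (proj₂ (proj₂ (proj₂ H))))
    above-w : ∀ u → SbarAt S ℓ u → w <lex u → v ⪯ u ⊎ w ⊥w u
    above-w = proj₁ (proj₂ (proj₂ (proj₂ (proj₂ (proj₂ H)))))

  extends : Extends S ℓ (PrecTail v w)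
  extends = extends-via (mk⇔ to from) (proj₂ (proj₂ (proj₂ (proj₂ (proj₂ (proj₂ H))))))
    where
    to : ∀ {u z} →
         (u <lex v × u ⊥w v × z ≡ u ∷ʳ X) ⊎ (u <lex v × ¬ (u ⊥w v) × z ≡ u ∷ʳ L)
         ⊎ (u ≡ v × z ≡ v ∷ʳ L) ⊎ (v <lex u × u <lex w × z ≡ u ∷ʳ X) ⊎ (u ≡ w × z ≡ w ∷ʳ R)
         ⊎ (w <lex u × w ⊥w u × z ≡ u ∷ʳ X) ⊎ (w <lex u × ¬ (w ⊥w u) × z ≡ u ∷ʳ R) →
         Σ Letter λ a → PrecTail v w u a × z ≡ u ∷ʳ a
    to (inj₁ (u<v , u⊥v , e)) = X , before-⊥ u<v u⊥v , e
    to (inj₂ (inj₁ (u<v , u∦v , e))) = L , before-∦ u<v u∦v , e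
    to (inj₂ (inj₂ (inj₁ (refl , e)))) = L , at-v , e
    to (inj₂ (inj₂ (inj₂ (inj₁ (v<u , u<w , e))))) = X , between v<u u<w , e
    to (inj₂ (inj₂ (inj₂ (inj₂ (inj₁ (refl , e)))))) = R , at-w , e
    to (inj₂ (inj₂ (inj₂ (inj₂ (inj₂ (inj₁ (w<u , w⊥u , e))))))) = X , after-⊥ w<u w⊥u , e
    to (inj₂ (inj₂ (inj₂ (inj₂ (inj₂ (inj₂ (w<u , w∦u , e))))))) = R , after-∦ w<u w∦u , e
    from : ∀ {u z} → (Σ Letter λ a → PrecTail v w u a × z ≡ u ∷ʳ a) →
           (u <lex v × u ⊥w v × z ≡ u ∷ʳ X) ⊎ (u <lex v × ¬ (u ⊥w v) × z ≡ u ∷ʳ L)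
           ⊎ (u ≡ v × z ≡ v ∷ʳ L) ⊎ (v <lex u × u <lex w × z ≡ u ∷ʳ X) ⊎ (u ≡ w × z ≡ w ∷ʳ R)
           ⊎ (w <lex u × w ⊥w u × z ≡ u ∷ʳ X) ⊎ (w <lex u × ¬ (w ⊥w u) × z ≡ u ∷ʳ R)
    from (_ , before-⊥ u<v u⊥v , e) = inj₁ (u<v , u⊥v , e)
    from (_ , before-∦ u<v u∦v , e) = inj₂ (inj₁ (u<v , u∦v , e))
    from (_ , at-v , e) = inj₂ (inj₂ (inj₁ (refl , e)))
    from (_ , between v<u u<w , e) = inj₂ (inj₂ (inj₂ (inj₁ (v<u , u<w , e))))
    from (_ , at-w , e) = inj₂ (inj₂ (inj₂ (inj₂ (inj₁ (refl , e)))))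
    from (_ , after-⊥ w<u w⊥u , e) = inj₂ (inj₂ (inj₂ (inj₂ (inj₂ (inj₁ (w<u , w⊥u , e))))))
    from (_ , after-∦ w<u w∦u , e) = inj₂ (inj₂ (inj₂ (inj₂ (inj₂ (inj₂ (w<u , w∦u , e))))))

  open Extension extends hiding (compatible-step)

  total : ∀ u → Σ Letter (PrecTail v w u)
  total u with <lex-trichotomy u v
  ... | inj₂ (inj₁ refl) = L , at-v
  ... | inj₁ u<v with u ⊥? v
  ...   | yes u⊥v = X , before-⊥ u<v u⊥v
  ...   | no u∦v = L , before-∦ u<v u∦v
  total u | inj₂ (inj₂ v<u) with <lex-trichotomy u w
  ... | inj₁ u<w = X , between v<u u<w
  ... | inj₂ (inj₁ refl) = R , at-w
  ... | inj₂ (inj₂ w<u) with w ⊥? u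
  ...   | yes w⊥u = X , after-⊥ w<u w⊥u
  ...   | no w∦u = R , after-∦ w<u w∦u

  v⊴w : v ⊴ w
  v⊴w = unrelated⇒⊴ unrelated v<w

  L-tail : ∀ {u} → SbarAt S ℓ u → PrecTail v w u L → u ⊴ v × (u ≡ v ⊎ u ≺ w)
  L-tail _ at-v = ⊴-refl , inj₁ refl
  L-tail su (before-∦ u<v u∦v) with below-v _ su u<v
  ... | inj₁ (inj₁ u≺w) = ∦-<lex⇒⊴ u∦v u<v , inj₂ u≺w
  ... | inj₁ (inj₂ refl) = ⊥-elim (<lex-irrefl (<lex-trans u<v v<w))
  ... | inj₂ u⊥v = ⊥-elim (u∦v u⊥v)

  R-tail : ∀ {u} → SbarAt S ℓ u → PrecTail v w u R → w ⊴ u × (u ≡ w ⊎ v ≺ u)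
  R-tail _ at-w = ⊴-refl , inj₁ refl
  R-tail su (after-∦ w<u w∦u) with above-w _ su w<u
  ... | inj₁ (inj₁ v≺u) = ∦-<lex⇒⊴ w∦u w<u , inj₂ v≺u
  ... | inj₁ (inj₂ refl) = ⊥-elim (<lex-irrefl (<lex-trans v<w w<u))
  ... | inj₂ w⊥u = ⊥-elim (w∦u w⊥u)

  X-tail : ∀ {u} → PrecTail v w u X → ¬ (u ⊴ v) × ¬ (w ⊴ u)
  X-tail (before-⊥ u<v u⊥v) = proj₁ u⊥v , λ w⊴u → ⊴⇒≯lex w⊴u (<lex-trans u<v v<w)
  X-tail (between v<u u<w) = (λ u⊴v → ⊴⇒≯lex u⊴v v<u) , λ w⊴u → ⊴⇒≯lex w⊴u u<w
  X-tail (after-⊥ w<u w⊥u) = (λ u⊴v → ⊴⇒≯lex u⊴v (<lex-trans v<w w<u)) , proj₁ w⊥u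

  w⋬v : ¬ (w ⊴ v)
  w⋬v w⊴v = ⊴⇒≯lex w⊴v v<w

  monotone : ∀ {p q a b} → SbarAt S ℓ p → SbarAt S ℓ q → p ⊴ q →
             PrecTail v w p a → PrecTail v w q b → a ≤L b
  monotone {a = L} {b = L} _ _ _ _ _ = ≤L-refl
  monotone {a = L} {b = X} _ _ _ _ _ = inj₁ L<X
  monotone {a = L} {b = R} _ _ _ _ _ = inj₁ L<R
  monotone {a = X} {b = X} _ _ _ _ _ = ≤L-refl
  monotone {a = X} {b = R} _ _ _ _ _ = inj₁ X<R
  monotone {a = R} {b = R} _ _ _ _ _ = ≤L-refl
  monotone {a = X} {b = L} _ sq d tp tq = ⊥-elim (proj₁ (X-tail tp) (⊴-trans d (proj₁ (L-tail sq tq))))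
  monotone {a = R} {b = X} sp _ d tp tq = ⊥-elim (proj₂ (X-tail tq) (⊴-trans (proj₁ (R-tail sp tp)) d))
  monotone {a = R} {b = L} sp sq d tp tq =
    ⊥-elim (w⋬v (⊴-trans (proj₁ (R-tail sp tp)) (⊴-trans d (proj₁ (L-tail sq tq)))))

  functional : Functional
  functional su ta tb = ≤L-antisym (monotone su su ⊴-refl ta tb) (monotone su su ⊴-refl tb ta)

  ∷ʳ-≺⇔ : ∀ {p q a b} → SbarAt S ℓ p → SbarAt S ℓ q → PrecTail v w p a → PrecTail v w q b →
          (p ∷ʳ a) ≺ (q ∷ʳ b) ⇔ (p ≺ q ⊎ (p ≡ v × q ≡ w))
  ∷ʳ-≺⇔ {p} {q} {a} {b} sp sq tp tq = mk⇔ to from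
    where
    to : (p ∷ʳ a) ≺ (q ∷ʳ b) → p ≺ q ⊎ (p ≡ v × q ≡ w)
    to r with ∷ʳ-≺⁻ (same-length sp sq) r
    ... | inj₁ p≺q = inj₁ p≺q
    ... | inj₂ (_ , refl , refl) with proj₂ (L-tail sp tp) | R-tail sq tq
    ...   | inj₁ p≡v | _ , inj₁ q≡w = inj₂ (p≡v , q≡w)
    ...   | inj₁ refl | _ , inj₂ v≺q = inj₁ v≺q
    ...   | inj₂ p≺w | _ , inj₁ refl = inj₁ p≺w
    ...   | inj₂ p≺w | w⊴q , inj₂ _ = inj₁ (≺-⊴-trans p≺w w⊴q)
    from : p ≺ q ⊎ (p ≡ v × q ≡ w) → (p ∷ʳ a) ≺ (q ∷ʳ b)
    from (inj₁ p≺q) = ∷ʳ-≺⁺ p≺q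
    from (inj₂ (refl , refl)) with functional sp tp at-v | functional sq tq at-w
    ... | refl | refl = ∷ʳ-≺-LR v⊴w

  conclusion : NewPrecConcl S ℓ
  conclusion =
    ρ-bijective functional (λ {u} _ → total u) ,
    ρ-preserves-≤lex functional ,
    ρ-preserves-⊴ monotone ,
    v , w , sv , sw , unrelated ∘ inj₁ ∘ inj₁ ,
    ρ-elim₂ (λ z z' p q → z ≺ z' ⇔ (p ≺ q ⊎ (p ≡ v × q ≡ w))) ∷ʳ-≺⇔

  compatible-step : CompatibleLevel S ℓ → CompatibleLevel S (suc ℓ)
  compatible-step = Extension.compatible-step extends
    (λ sp sq p<q tp tq →
      <lex⇒≱lex (<lex-trans (<lex-≤lex-trans p<q (⊴⇒≤lex (proj₁ (L-tail sq tq)))) v<w)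
                (⊴⇒≤lex (proj₁ (R-tail sp tp))))
    (λ sp sq _ tp tq → ⊴-trans (proj₁ (L-tail sp tp)) (⊴-trans v⊴w (proj₁ (R-tail sq tq))))
    (λ sp sq _ d → monotone sp sq d)

below-sup : ∀ {S ℓ z} → SbarAt S (suc ℓ) z → BelowSup S ℓ
below-sup {ℓ = ℓ} ((w , sw , i , _ , w|i≡z) , |z|≡1+ℓ) =
  w , sw , subst (_≤ length w) i⊓|w|≡1+ℓ (m⊓n≤n i (length w))
  where
  i⊓|w|≡1+ℓ : i ⊓ length w ≡ suc ℓ
  i⊓|w|≡1+ℓ = trans (sym (length-take i w)) (trans (cong length w|i≡z) |z|≡1+ℓ)

take-SbarAt : ∀ {S u} n → Sbar S u → n ≤ length u → SbarAt S n (take n u)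
take-SbarAt {u = u} n (w , sw , i , i≤|w| , w|i≡u) n≤|u| =
  (w , sw , n ⊓ i , ≤-trans (m⊓n≤n n i) i≤|w| , trans (sym (take-take n i w)) (cong (take n) w|i≡u)) ,
  trans (length-take n u) (m≤n⇒m⊓n≡m n≤|u|)

compatible-zero : ∀ {S} → CompatibleLevel S zero
compatible-zero [] [] _ _ _ = compatible-refl []
compatible-zero (_ ∷ _) _ (_ , ()) _ _
compatible-zero [] (_ ∷ _) _ (_ , ()) _

compatible-suc : ∀ {S ℓ} → PosetDiary S → BelowSup S ℓ → CompatibleLevel S ℓ → CompatibleLevel S (suc ℓ)
compatible-suc {ℓ = ℓ} (_ , levels) below with proj₁ (levels ℓ below)
... | inj₁ (_ , H) = Leaf.compatible-step H
... | inj₂ (inj₁ (_ , H)) = Split.compatible-step H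
... | inj₂ (inj₂ (inj₁ (_ , _ , H))) = NewPerp.compatible-step H
... | inj₂ (inj₂ (inj₂ (_ , _ , H))) = NewPrec.compatible-step H

levels-compatible : ∀ {S} → PosetDiary S → ∀ ℓ → CompatibleLevel S ℓ
levels-compatible D zero = compatible-zero
levels-compatible D (suc ℓ) z z' sz = compatible-suc D (below-sup sz) (levels-compatible D ℓ) z z' sz

Sbar-compatible : ∀ {S} → PosetDiary S → ∀ u v → Sbar S u → Sbar S v → u ≤lex v → Compatible u v
Sbar-compatible D u v su sv u≤v =
  compatible-truncate u v
    (levels-compatible D n _ _ (take-SbarAt n su (m⊓n≤m _ _)) (take-SbarAt n sv (m⊓n≤n _ _)) (take-≤lex n u≤v))
  where
  n : ℕ
  n = length u ⊓ length v

mainTheorem3 : (S : Word → Set) → PosetDiary S →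
    (∀ u v → Sbar S u → Sbar S v → u ≤lex v → Compatible u v)
    × (∀ ℓ → BelowSup S ℓ →
        (∀ w → LeafAt S ℓ w → LeafConcl S ℓ w)
        × (∀ w → SplitAt S ℓ w → SplitConcl S ℓ w)
        × (∀ v w → NewPerpAt S ℓ v w → NewPerpConcl S ℓ)
        × (∀ v w → NewPrecAt S ℓ v w → NewPrecConcl S ℓ))
mainTheorem3 S D =
  Sbar-compatible D ,
  λ ℓ _ → (λ _ → Leaf.conclusion) , (λ _ → Split.conclusion) ,
          (λ _ _ → NewPerp.conclusion) , (λ _ _ → NewPrec.conclusion)
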